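{- Let $\mathcal{G}$ be a family of finite simple graphs which is closed under the operation of taking the disjoint union with an isolated vertex (i.e. if $G\in\mathcal{G}$ then the graph obtained from $G$ by adding one new vertex adjacent to nothing also lies in $\mathcal{G}$). Suppose that every $G\in\mathcal{G}$ on $n$ vertices satisfies $\operatorname{lcc}(G)+\operatorname{lcc}(\overline{G})\leq n$. Then every $G\in\mathcal{G}$ on $n$ vertices satisfies $\operatorname{lcc}(G)+\chi(G)\leq n+1$.
   Context: All graphs are finite, simple and undirected; $\overline{G}$ denotes the complement of $G$ and $\chi(G)$ its chromatic number. A clique of $G$ is a set of pairwise adjacent vertices. A clique covering of $E(G)$ is a family $\mathcal{C}$ of cliques of $G$ such that every edge of $G$ lies in at least one member of $\mathcal{C}$. For a vertex $v$, its valency $val_{\mathcal{C}}(v)$ is the number of cliques in $\mathcal{C}$ containing $v$. The local clique cover number $\operatorname{lcc}(G)$ is the smallest integer $k$ such that there is a clique covering $\mathcal{C}$ of $E(G)$ with $val_{\mathcal{C}}(v)\le k$ for every vertex $v$ of $G$. -}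

module Defs where

open import Data.Nat using (ℕ; zero; suc; _+_; _≤_)
open import Data.Fin using (Fin; zero; suc)
open import Data.Bool using (Bool; true; false; not)
open import Data.List using (List; length; filterᵇ)
open import Data.List.Relation.Unary.Any using (Any)
open import Data.Product using (Σ; _×_; ∃)
open import Relation.Binary.PropositionalEquality using (_≡_; _≢_)
import Relation.Binary.PropositionalEquality
import Relation.Nullary
import Data.Empty
import Data.Fin
import Data.List.Relation.Unary.All

record Graph (n : ℕ) : Set where
  field
    adj     : Fin n → Fin n → Bool
    symm    : ∀ u v → adj u v ≡ adj v u
    irrefl  : ∀ v → adj v v ≡ false
open Graph public

complement : ∀ {n} → Graph n → Graph n
complement {n} G = record { adj = a ; symm = s ; irrefl = i }
  where
  a : Fin n → Fin n → Bool
  a u v with Data.Fin._≟_ u v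
  ... | Relation.Nullary.yes _ = false
  ... | Relation.Nullary.no  _ = not (adj G u v)
  s : ∀ u v → a u v ≡ a v u
  s u v with Data.Fin._≟_ u v | Data.Fin._≟_ v u
  ... | Relation.Nullary.yes _ | Relation.Nullary.yes _ = Relation.Binary.PropositionalEquality.refl
  ... | Relation.Nullary.yes p | Relation.Nullary.no ¬q = Data.Empty.⊥-elim (¬q (Relation.Binary.PropositionalEquality.sym p))
  ... | Relation.Nullary.no ¬p | Relation.Nullary.yes q = Data.Empty.⊥-elim (¬p (Relation.Binary.PropositionalEquality.sym q))
  ... | Relation.Nullary.no _ | Relation.Nullary.no _ = Relation.Binary.PropositionalEquality.cong not (symm G u v)
  i : ∀ v → a v v ≡ false
  i v with Data.Fin._≟_ v v
  ... | Relation.Nullary.yes _ = Relation.Binary.PropositionalEquality.refl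
  ... | Relation.Nullary.no ¬p = Data.Empty.⊥-elim (¬p Relation.Binary.PropositionalEquality.refl)

addIsolated : ∀ {n} → Graph n → Graph (suc n)
addIsolated {n} G = record { adj = a ; symm = s ; irrefl = i }
  where
  a : Fin (suc n) → Fin (suc n) → Bool
  a zero    _       = false
  a (suc _) zero    = false
  a (suc u) (suc v) = adj G u v
  s : ∀ u v → a u v ≡ a v u
  s zero zero = Relation.Binary.PropositionalEquality.refl
  s zero (suc v) = Relation.Binary.PropositionalEquality.refl
  s (suc u) zero = Relation.Binary.PropositionalEquality.refl
  s (suc u) (suc v) = symm G u v
  i : ∀ v → a v v ≡ false
  i zero = Relation.Binary.PropositionalEquality.refl
  i (suc v) = irrefl G v

VSet : ℕ → Set
VSet n = Fin n → Bool

IsClique : ∀ {n} → Graph n → VSet n → Set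
IsClique G C = ∀ u v → u ≢ v → C u ≡ true → C v ≡ true → adj G u v ≡ true

record CliqueCovering {n : ℕ} (G : Graph n) : Set where
  field
    cliques  : List (VSet n)
    allCliq  : Data.List.Relation.Unary.All.All (IsClique G) cliques
    covers   : ∀ u v → adj G u v ≡ true →
               Any (λ C → (C u ≡ true) × (C v ≡ true)) cliques
open CliqueCovering public

val : ∀ {n} {G : Graph n} → CliqueCovering G → Fin n → ℕ
val 𝒞 v = length (filterᵇ (λ C → C v) (cliques 𝒞))

HasLocalCover : ∀ {n} → Graph n → ℕ → Set
HasLocalCover G k = Σ (CliqueCovering G) (λ 𝒞 → ∀ v → val 𝒞 v ≤ k)

IsLcc : ∀ {n} → Graph n → ℕ → Set
IsLcc G k = HasLocalCover G k × (∀ j → HasLocalCover G j → k ≤ j)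

Colorable : ∀ {n} → Graph n → ℕ → Set
Colorable {n} G k = Σ (Fin n → Fin k) (λ c → ∀ u v → adj G u v ≡ true → c u ≢ c v)

IsChi : ∀ {n} → Graph n → ℕ → Set
IsChi G k = Colorable G k × (∀ j → Colorable G j → k ≤ j)

-- Let G⁺ be G with an isolated vertex z added; lcc(G⁺) = lcc(G). In the
-- complement of G⁺, z is adjacent to every other vertex, so in a covering of
-- it with valencies at most b the at most b cliques through z, with z removed,
-- are independent sets of G covering every vertex. Hence χ(G) ≤ b, and with
-- b = lcc(complement G⁺) the hypothesis for G⁺ gives lcc(G) + χ(G) ≤ n + 1.
-- The least b exists only under a double negation, which is harmless because
-- the conclusion is decidable.
module Submission where

open import Defs
open import Data.Nat using (ℕ; suc; _+_; _≤_; _<_; _≤?_; z≤n)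
open import Data.Nat.Properties using (≰⇒>; +-monoʳ-≤; module ≤-Reasoning)
open import Data.Nat.Induction using (<-rec)
open import Data.Fin using (Fin; zero; suc; _≟_)
open import Data.Fin.Properties using (suc-injective)
open import Data.Bool using (Bool; true; false; _∧_; _∨_; T?)
open import Data.Bool.Properties using (∨-zeroʳ)
open import Data.List as List using (List; []; _∷_; length; filterᵇ; map; cartesianProduct; allFin)
open import Data.List.Properties using (length-filter; length-map)
open import Data.List.Relation.Unary.Any as Any using (Any; here; there; index)
open import Data.List.Relation.Unary.Any.Properties using (lookup-result) renaming (map⁺ to Any-map⁺)
open import Data.List.Relation.Unary.All as All using (All; lookupAny)
open import Data.List.Relation.Unary.All.Properties using () renaming (map⁺ to All-map⁺; filter⁺ to All-filter⁺)
open import Data.List.Membership.Propositional.Properties using (∈-cartesianProduct⁺; ∈-allFin)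
open import Data.Vec.Functional using (tail) renaming (_∷_ to _∷ᶠ_)
open import Data.Product using (∃; _×_; _,_; proj₁; proj₂; uncurry)
open import Data.Sum using (_⊎_; inj₁; inj₂)
open import Relation.Nullary using (¬_; yes; no; does; contradiction)
open import Relation.Nullary.Decidable using (decidable-stable; dec-true)
open import Relation.Binary.PropositionalEquality using (_≡_; _≢_; refl; sym; trans; cong; subst)

private
  variable
    A B : Set
    n k : ℕ

Least : (ℕ → Set) → Set
Least P = ∃ λ m → P m × (∀ j → P j → m ≤ j)

¬¬-least : (P : ℕ → Set) {k : ℕ} → P k → ¬ ¬ Least P
¬¬-least P {k} = <-rec (λ k → P k → ¬ ¬ Least P) step k
  where
  step : ∀ k → (∀ {j} → j < k → P j → ¬ ¬ Least P) → P k → ¬ ¬ Least P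
  step k rec pk ¬least = ¬least (k , pk , λ j pj →
    decidable-stable (_ ≤? _) λ k≰j → rec (≰⇒> k≰j) pj ¬least)

length-filterᵇ-map : (p : B → Bool) (f : A → B) (xs : List A) →
                     length (filterᵇ p (map f xs)) ≡ length (filterᵇ (λ x → p (f x)) xs)
length-filterᵇ-map p f []       = refl
length-filterᵇ-map p f (x ∷ xs) with p (f x)
... | true  = cong suc (length-filterᵇ-map p f xs)
... | false = length-filterᵇ-map p f xs

filterᵇ-false : (xs : List A) → filterᵇ (λ _ → false) xs ≡ []
filterᵇ-false []       = refl
filterᵇ-false (x ∷ xs) = filterᵇ-false xs

Any-filterᵇ⁺ : {P : A → Set} (p : A → Bool) {xs : List A} →
               Any (λ x → p x ≡ true × P x) xs → Any P (filterᵇ p xs)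
Any-filterᵇ⁺ p {x ∷ _} (here (px , Px)) rewrite px = here Px
Any-filterᵇ⁺ p {x ∷ _} (there q) with p x
... | true  = there (Any-filterᵇ⁺ p q)
... | false = Any-filterᵇ⁺ p q

-- Empty unless uv is an edge, so that it is a clique for every pair u, v.
edgeClique : Graph n → Fin n → Fin n → VSet n
edgeClique H u v w = adj H u v ∧ (does (w ≟ u) ∨ does (w ≟ v))

edgeClique⁻ : (H : Graph n) (u v w : Fin n) → edgeClique H u v w ≡ true →
              adj H u v ≡ true × (w ≡ u ⊎ w ≡ v)
edgeClique⁻ H u v w e with adj H u v | w ≟ u | w ≟ v
... | true | yes w≡u | _       = refl , inj₁ w≡u
... | true | no _    | yes w≡v = refl , inj₂ w≡v

edgeClique-isClique : (H : Graph n) (u v : Fin n) → IsClique H (edgeClique H u v)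
edgeClique-isClique H u v x y x≢y ex ey
  with edgeClique⁻ H u v x ex | edgeClique⁻ H u v y ey
... | uv , inj₁ refl | _ , inj₁ refl = contradiction refl x≢y
... | uv , inj₁ refl | _ , inj₂ refl = uv
... | uv , inj₂ refl | _ , inj₁ refl = trans (symm H x y) uv
... | uv , inj₂ refl | _ , inj₂ refl = contradiction refl x≢y

edgeClique-ends : (H : Graph n) (u v : Fin n) → adj H u v ≡ true →
                  edgeClique H u v u ≡ true × edgeClique H u v v ≡ true
edgeClique-ends H u v e rewrite e | dec-true (u ≟ u) refl | dec-true (v ≟ v) refl =
  refl , ∨-zeroʳ (does (v ≟ u))

hasLocalCover : (H : Graph n) → ∃ (HasLocalCover H)
hasLocalCover {n} H = length cs , 𝒞 , λ v → length-filter (λ C → T? (C v)) cs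
  where
  cs : List (VSet n)
  cs = map (uncurry (edgeClique H)) (cartesianProduct (allFin n) (allFin n))
  𝒞 : CliqueCovering H
  𝒞 = record
    { cliques = cs
    ; allCliq = All-map⁺ (All.universal (uncurry (edgeClique-isClique H)) _)
    ; covers  = λ u v e → Any-map⁺ (Any.map (λ { refl → edgeClique-ends H u v e })
                                             (∈-cartesianProduct⁺ (∈-allFin u) (∈-allFin v)))
    }

¬¬-lcc : (H : Graph n) → ¬ ¬ ∃ (IsLcc H)
¬¬-lcc H = ¬¬-least (HasLocalCover H) (proj₂ (hasLocalCover H))

HasLocalCover-addIsolated⁺ : (G : Graph n) → HasLocalCover G k → HasLocalCover (addIsolated G) k
HasLocalCover-addIsolated⁺ {k = k} G (𝒞 , val≤k) = 𝒞⁺ , val⁺≤k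
  where
  lift-isClique : ∀ {C} → IsClique G C → IsClique (addIsolated G) (false ∷ᶠ C)
  lift-isClique C-clique (suc u) (suc v) u≢v = C-clique u v (λ u≡v → u≢v (cong suc u≡v))
  cover : ∀ u v → adj (addIsolated G) u v ≡ true →
          Any (λ C → C u ≡ true × C v ≡ true) (map (false ∷ᶠ_) (cliques 𝒞))
  cover (suc u) (suc v) e = Any-map⁺ (covers 𝒞 u v e)
  𝒞⁺ : CliqueCovering (addIsolated G)
  𝒞⁺ = record
    { cliques = map (false ∷ᶠ_) (cliques 𝒞)
    ; allCliq = All-map⁺ (All.map lift-isClique (allCliq 𝒞))
    ; covers  = cover
    }
  val⁺≤k : ∀ v → val 𝒞⁺ v ≤ k
  val⁺≤k zero
    rewrite length-filterᵇ-map (λ C → C zero) (false ∷ᶠ_) (cliques 𝒞) | filterᵇ-false (cliques 𝒞) = z≤n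
  val⁺≤k (suc v)
    rewrite length-filterᵇ-map (λ C → C (suc v)) (false ∷ᶠ_) (cliques 𝒞) = val≤k v

HasLocalCover-addIsolated⁻ : (G : Graph n) → HasLocalCover (addIsolated G) k → HasLocalCover G k
HasLocalCover-addIsolated⁻ {k = k} G (𝒞 , val≤k) = 𝒞⁻ , val⁻≤k
  where
  𝒞⁻ : CliqueCovering G
  𝒞⁻ = record
    { cliques = map tail (cliques 𝒞)
    ; allCliq = All-map⁺ (All.map (λ C-clique u v u≢v → C-clique (suc u) (suc v) (λ e → u≢v (suc-injective e)))
                                  (allCliq 𝒞))
    ; covers  = λ u v e → Any-map⁺ (covers 𝒞 (suc u) (suc v) e)
    }
  val⁻≤k : ∀ v → val 𝒞⁻ v ≤ k
  val⁻≤k v rewrite length-filterᵇ-map (λ C → C v) tail (cliques 𝒞) = val≤k (suc v)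

IsLcc-addIsolated : (G : Graph n) → IsLcc G k → IsLcc (addIsolated G) k
IsLcc-addIsolated G (cover , least) =
  HasLocalCover-addIsolated⁺ G cover , λ j cover⁺ → least j (HasLocalCover-addIsolated⁻ G cover⁺)

IsIndependent : Graph n → VSet n → Set
IsIndependent G I = ∀ u v → I u ≡ true → I v ≡ true → adj G u v ≡ false

complement-adj⇒¬adj : (H : Graph n) (u v : Fin n) → adj (complement H) u v ≡ true → adj H u v ≡ false
complement-adj⇒¬adj H u v e with u ≟ v
... | no _ with adj H u v
...   | false = refl

complement-clique⇒independent : (H : Graph n) {C : VSet n} → IsClique (complement H) C → IsIndependent H C
complement-clique⇒independent H C-clique u v Cu Cv with u ≟ v
... | yes refl = irrefl H u
... | no u≢v   = complement-adj⇒¬adj H u v (C-clique u v u≢v Cu Cv)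

independentCover⇒colorable : (G : Graph n) (Is : List (VSet n)) → All (IsIndependent G) Is →
                             (∀ v → Any (λ I → I v ≡ true) Is) → Colorable G (length Is)
independentCover⇒colorable {n} G Is independent covered = colour , proper
  where
  colour : Fin n → Fin (length Is)
  colour v = index (covered v)
  proper : ∀ u v → adj G u v ≡ true → colour u ≢ colour v
  proper u v u~v same with lookupAny independent (covered u)
  ... | I-independent , Iu = contradiction (trans (sym u~v) (I-independent u v Iu Iv)) λ ()
    where
    Iv : Any.lookup (covered u) v ≡ true
    Iv = subst (λ I → I v ≡ true) (cong (List.lookup Is) (sym same)) (lookup-result (covered v))

χ≤localCover-complement-addIsolated : ∀ {b c} (G : Graph n) → IsChi G c →
                                      HasLocalCover (complement (addIsolated G)) b → c ≤ b
χ≤localCover-complement-addIsolated {n} {b} {c} G (_ , χ-least) (𝒞 , val≤b) = begin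
  c                        ≤⟨ χ-least _ (independentCover⇒colorable G (map tail Z) independent covered) ⟩
  length (map tail Z)      ≡⟨ length-map tail Z ⟩
  val 𝒞 zero               ≤⟨ val≤b zero ⟩
  b                        ∎
  where
  open ≤-Reasoning
  Z : List (VSet (suc n))
  Z = filterᵇ (λ C → C zero) (cliques 𝒞)
  independent : All (IsIndependent G) (map tail Z)
  independent = All-map⁺ (All.map (λ C-clique u v → complement-clique⇒independent (addIsolated G) C-clique (suc u) (suc v))
                                  (All-filter⁺ (λ C → T? (C zero)) (allCliq 𝒞)))
  -- In the complement the isolated vertex is adjacent to every other vertex.
  covered : ∀ v → Any (λ I → I v ≡ true) (map tail Z)
  covered v = Any-map⁺ (Any-filterᵇ⁺ (λ C → C zero) (covers 𝒞 zero (suc v) refl))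

lemma4 : (𝒢 : (n : ℕ) → Graph n → Set) →
    (∀ n (G : Graph n) → 𝒢 n G → 𝒢 (suc n) (addIsolated G)) →
    (∀ n (G : Graph n) → 𝒢 n G → ∀ a b → IsLcc G a → IsLcc (complement G) b → a + b ≤ n) →
    ∀ n (G : Graph n) → 𝒢 n G → ∀ a c → IsLcc G a → IsChi G c → a + c ≤ suc n
lemma4 𝒢 closed lcc+lcc≤n n G G∈𝒢 a c lccG χG =
  decidable-stable (a + c ≤? suc n) λ a+c≰1+n →
    ¬¬-lcc Gᶜ λ (b , lccGᶜ) → a+c≰1+n (begin
      a + c  ≤⟨ +-monoʳ-≤ a (χ≤localCover-complement-addIsolated G χG (proj₁ lccGᶜ)) ⟩
      a + b  ≤⟨ lcc+lcc≤n (suc n) (addIsolated G) (closed n G G∈𝒢) a b (IsLcc-addIsolated G lccG) lccGᶜ ⟩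
      suc n  ∎)
  where
  open ≤-Reasoning
  Gᶜ : Graph (suc n)
  Gᶜ = complement (addIsolated G)
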